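{- Let $M$ be a finite ordinal monoid with merge and let $K,L\subseteq M^{\mathrm{ord}}$ be FO-definable languages. If there are FO-approximants of $\pi$ over $K$ and over $L$, then there effectively exist FO-approximants of $\pi$ over $K\cup L$ and over $KL=\{uv:u\in K,v\in L\}$.
   Context: Countable ordinal words over $X$: maps from a countable ordinal to $X$; $X^{\mathrm{ord}}$ is their set. A finite ordinal monoid with merge is a finite ordinal monoid $(M,\pi)$ ($\pi:M^{\mathrm{ord}}\to M$ with $\pi(x)=x$ and generalised associativity) equipped with a partial order $\leqslant$ making $\pi$ monotone for the letterwise order, and with a monotone map $-^{\mathrm{merge}}:M\to M$ satisfying, for all $a,b$ and integers $k$: $a^{\mathrm{idem}+k}\leqslant a^{\mathrm{merge}}$, $(a^{\mathrm{idem}})^{\mathrm{merge}}=a^{\mathrm{idem}}$, $a^{\mathrm{merge}}a^{\mathrm{merge}}=(a^{\mathrm{merge}})^{\mathrm{merge}}=a^{\mathrm{merge}}$, $(ab)^{\mathrm{merge}}=a(ba)^{\mathrm{merge}}b$. First-order logic over the finite alphabet $M$ uses $<$ and letter predicates. A map $f:L\to X$, $X$ finite, is FO-definable if every preimage is an FO-definable language. Given an FO-definable $L\subseteq M^{\mathrm{ord}}$, an FO-approximant of $\pi$ over $L$ is an FO-definable map $\rho:L\to M$ with $\pi(u)\leqslant\rho(u)$ for all $u\in L$. -}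

module Defs where

open import Level using (0ℓ) renaming (suc to lsuc)
open import Data.Nat using (ℕ; zero; suc; _+_; _*_; _∸_; _!)
open import Data.Integer using (ℤ; +_; -[1+_])
open import Data.Fin using (Fin; toℕ) renaming (_<_ to _<ᶠ_)
import Data.Fin.Properties as FinP
import Data.Fin.Induction as FinI
open import Data.Product using (Σ; Σ-syntax; _×_; _,_; proj₁; proj₂)
open import Data.Sum using (_⊎_; inj₁; inj₂; [_,_])
open import Data.Empty using (⊥)
open import Data.Unit using (⊤)
open import Relation.Nullary using (¬_)
open import Relation.Binary.PropositionalEquality using (_≡_; subst)
open import Relation.Binary.Structures using (IsStrictTotalOrder; IsPartialOrder)
open import Induction.WellFounded using (WellFounded)
open import Function.Definitions using (Injective)
open import Function.Bundles using (_↔_; Inverse; _⇔_)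

record CountableOrdinal : Set₁ where
  field
    Pos      : Set
    _≺_      : Pos → Pos → Set
    isSTO    : IsStrictTotalOrder _≡_ _≺_
    wf       : WellFounded _≺_
    enc      : Pos → ℕ
    enc-inj  : Injective _≡_ _≡_ enc

open CountableOrdinal public

finOrd : ℕ → CountableOrdinal
finOrd n = record
  { Pos = Fin n ; _≺_ = _<ᶠ_ ; isSTO = FinP.<-isStrictTotalOrder
  ; wf = FinI.<-wellFounded ; enc = toℕ ; enc-inj = FinP.toℕ-injective }

record OWord (X : Set) : Set₁ where
  constructor mkWord
  field
    dom    : CountableOrdinal
    letter : Pos dom → X

open OWord public

P : {X : Set} → OWord X → Set
P w = Pos (dom w)

LexΣ : {X : Set} (α : CountableOrdinal) (u : Pos α → OWord X) →
       Σ (Pos α) (λ i → P (u i)) → Σ (Pos α) (λ i → P (u i)) → Set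
LexΣ α u (i , p) (j , q) =
  _≺_ α i j ⊎ Σ (i ≡ j) (λ e → _≺_ (dom (u j)) (subst (λ k → P (u k)) e p) q)

-- w is (isomorphic to) the ordered concatenation Π_{i ∈ α} u i
record IsConcat {X : Set} (w : OWord X) (α : CountableOrdinal)
                (u : Pos α → OWord X) : Set₁ where
  field
    iso      : P w ↔ Σ (Pos α) (λ i → P (u i))
  open Inverse iso
  field
    iso-ord    : ∀ x y → (_≺_ (dom w) x y ⇔ LexΣ α u (to x) (to y))
    iso-letter : ∀ x → letter w x ≡ letter (u (proj₁ (to x))) (proj₂ (to x))

Lex⊎ : {A B : Set} → (A → A → Set) → (B → B → Set) → A ⊎ B → A ⊎ B → Set
Lex⊎ r s (inj₁ a) (inj₁ a') = r a a'
Lex⊎ r s (inj₁ a) (inj₂ b)  = ⊤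
Lex⊎ r s (inj₂ b) (inj₁ a)  = ⊥
Lex⊎ r s (inj₂ b) (inj₂ b') = s b b'

-- w is (isomorphic to) the concatenation u v
record IsConcat₂ {X : Set} (w u v : OWord X) : Set₁ where
  field
    iso      : P w ↔ (P u ⊎ P v)
  open Inverse iso
  field
    iso-ord    : ∀ x y → (_≺_ (dom w) x y ⇔ Lex⊎ (_≺_ (dom u)) (_≺_ (dom v)) (to x) (to y))
    iso-letter : ∀ x → letter w x ≡ [ letter u , letter v ] (to x)

Lang : Set → Set₂
Lang X = OWord X → Set₁

_∪ᴸ_ : {X : Set} → Lang X → Lang X → Lang X
(K ∪ᴸ L) w = K w ⊎ L w

_·ᴸ_ : {X : Set} → Lang X → Lang X → Lang X
(K ·ᴸ L) w = Σ[ u ∈ OWord _ ] Σ[ v ∈ OWord _ ] (K u × L v × IsConcat₂ w u v)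

data Formula (A : Set) : ℕ → Set where
  Lt   : ∀ {n} → Fin n → Fin n → Formula A n
  Eq   : ∀ {n} → Fin n → Fin n → Formula A n
  Let  : ∀ {n} → A → Fin n → Formula A n
  Neg  : ∀ {n} → Formula A n → Formula A n
  And  : ∀ {n} → Formula A n → Formula A n → Formula A n
  Or   : ∀ {n} → Formula A n → Formula A n → Formula A n
  Ex   : ∀ {n} → Formula A (suc n) → Formula A n
  All  : ∀ {n} → Formula A (suc n) → Formula A n

Sentence : Set → Set
Sentence A = Formula A 0

extend : {B : Set} {n : ℕ} → B → (Fin n → B) → Fin (suc n) → B
extend b ρ Fin.zero    = b
extend b ρ (Fin.suc i) = ρ i

Sat : {A : Set} (w : OWord A) {n : ℕ} → Formula A n → (Fin n → P w) → Set
Sat w (Lt x y)  e = _≺_ (dom w) (e x) (e y)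
Sat w (Eq x y)  e = e x ≡ e y
Sat w (Let a x) e = letter w (e x) ≡ a
Sat w (Neg φ)   e = ¬ Sat w φ e
Sat w (And φ ψ) e = Sat w φ e × Sat w ψ e
Sat w (Or φ ψ)  e = Sat w φ e ⊎ Sat w ψ e
Sat w (Ex φ)    e = Σ[ p ∈ P w ] Sat w φ (extend p e)
Sat w (All φ)   e = (p : P w) → Sat w φ (extend p e)

_⊨_ : {A : Set} → OWord A → Sentence A → Set
w ⊨ φ = Sat w φ (λ ())

FODefinable : {A : Set} → Lang A → Set₁
FODefinable {A} L = Σ[ φ ∈ Sentence A ] (∀ w → L w ⇔ (w ⊨ φ))

-- an FO-definable map f : L → X (X finite): a map on L, whose value
-- does not depend on the membership witness, together with sentences
-- defining every preimage f⁻¹(x)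
record FODefinableMap {A : Set} (L : Lang A) (X : Set) : Set₁ where
  field
    fun      : (w : OWord A) → L w → X
    fun-irr  : ∀ w (h h' : L w) → fun w h ≡ fun w h'
    preimDef : X → Sentence A
    preimDef-spec : ∀ x w → (Σ[ h ∈ L w ] fun w h ≡ x) ⇔ (w ⊨ preimDef x)

record OrdinalMonoid : Set₁ where
  field
    Carrier : Set
    size    : ℕ
    enum    : Fin size ↔ Carrier
    π       : OWord Carrier → Carrier
    π-single : ∀ (w : OWord Carrier) (p : P w) → (∀ q → q ≡ p) → π w ≡ letter w p
    π-assoc  : ∀ (w : OWord Carrier) (α : CountableOrdinal)
                 (u : Pos α → OWord Carrier) → IsConcat w α u →
                 π w ≡ π (mkWord α (λ i → π (u i)))

module _ (M : OrdinalMonoid) where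
  open OrdinalMonoid M

  unit : Carrier
  unit = π (mkWord (finOrd 0) (λ ()))

  mul : Carrier → Carrier → Carrier
  mul a b = π (mkWord (finOrd 2) f)
    where f : Fin 2 → Carrier
          f Fin.zero = a
          f (Fin.suc _) = b

  power : Carrier → ℕ → Carrier
  power a zero    = unit
  power a (suc k) = mul a (power a k)

  -- a^idem = a^(|M|!), the idempotent power of a
  idem : Carrier → Carrier
  idem a = power a (size !)

  -- a^(idem + k) for an integer k
  idemPlus : Carrier → ℤ → Carrier
  idemPlus a (+ k)      = power a (size ! + k)
  idemPlus a -[1+ k ]   = power a (size ! + (size ! * suc k ∸ suc k))

record OrdinalMonoidWithMerge : Set₂ where
  field
    om : OrdinalMonoid
  open OrdinalMonoid om
  field
    _≤_      : Carrier → Carrier → Set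
    isPO     : IsPartialOrder _≡_ _≤_
    π-mono   : ∀ (α : CountableOrdinal) (f g : Pos α → Carrier) →
                 (∀ i → f i ≤ g i) → π (mkWord α f) ≤ π (mkWord α g)
    merge    : Carrier → Carrier
    merge-mono : ∀ a b → a ≤ b → merge a ≤ merge b
    merge-ax1 : ∀ a (k : ℤ) → idemPlus om a k ≤ merge a
    merge-ax2 : ∀ a → merge (idem om a) ≡ idem om a
    merge-ax3 : ∀ a → mul om (merge a) (merge a) ≡ merge a
    merge-ax4 : ∀ a → merge (merge a) ≡ merge a
    merge-ax5 : ∀ a b → merge (mul om a b) ≡ mul om a (mul om (merge (mul om b a)) b)

module _ (M : OrdinalMonoidWithMerge) where
  open OrdinalMonoidWithMerge M
  open OrdinalMonoid om

  CarrierM : Set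
  CarrierM = Carrier

  -- the type of an effective construction: from the defining sentences
  -- of K and L and the preimage-defining sentences of approximants over
  -- K and L, produce preimage-defining sentences of the new approximant
  Construction : Set
  Construction = Sentence Carrier → Sentence Carrier →
                 (Carrier → Sentence Carrier) → (Carrier → Sentence Carrier) →
                 (Carrier → Sentence Carrier)

  record FOApproximant (L : Lang Carrier) : Set₁ where
    field
      map    : FODefinableMap L Carrier
    open FODefinableMap map
    field
      approx : ∀ w (h : L w) → π w ≤ fun w h

{-# OPTIONS --safe #-}
module Submission where

-- A union approximant maps w to any m whose preimage sentence, for the
-- approximant over K or over L, holds in w.  For a product, w satisfies
-- cut(a, b) when a position x splits it into a prefix satisfying the
-- K-sentence for a (relativised to the positions before x) and a suffix
-- satisfying the L-sentence for b, or when the whole of w satisfies the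
-- K-sentence for a and the empty word the L-sentence for b; by generalised
-- associativity and monotonicity π w = π u · π v ≤ a · b, so a · b is an
-- admissible value.  Both relations are first-order but not functional: a
-- map is obtained by taking the first admissible value in an enumeration of
-- M, which is again first-order.  Excluded middle decides satisfaction over
-- infinite ordinals and finds the first position of the second factor.

open import Defs
open import Level using (0ℓ; Lift; lift; lower) renaming (suc to lsuc)
open import Data.Nat using (ℕ; zero; suc; _+_; z≤n; s≤s)
open import Data.Fin using (Fin; _↑ˡ_; _↑ʳ_) renaming (_<_ to _<ᶠ_)
import Data.Fin.Properties as Finₚ
open import Data.Bool using (Bool; true; false; T; not)
open import Data.Bool.Properties using (T-irrelevant)
open import Data.Product using (Σ; Σ-syntax; _×_; _,_; proj₁; proj₂)
open import Data.Sum using (_⊎_; inj₁; inj₂; [_,_])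
open import Data.Sum.Properties using (inj₁-injective; inj₂-injective)
open import Data.Empty using (⊥-elim)
open import Data.Unit using (tt)
open import Function using (_∘_; id)
open import Function.Bundles using (_⇔_; mk⇔; Equivalence; _↔_; mk↔ₛ′; Inverse)
open import Function.Construct.Composition using (_↔-∘_)
open import Function.Properties.Inverse using (↔-sym; ↔⇒↣)
open import Relation.Nullary using (¬_; Dec; yes; no)
open import Relation.Nullary.Decidable using (map′; isYes; toWitness; fromWitness; via-injection)
open import Relation.Binary.PropositionalEquality
  using (_≡_; refl; sym; trans; cong; subst; subst₂; isEquivalence)
open import Relation.Binary.Structures using (IsStrictTotalOrder)
open import Relation.Binary.Definitions using (DecidableEquality; Tri; tri<; tri≈; tri>)
import Relation.Binary.Construct.On as On
open import Induction.WellFounded using (WellFounded; Acc; acc)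
open import Axiom.ExcludedMiddle using (ExcludedMiddle)

open Equivalence using (to; from)

T-not⇔¬T : ∀ b → T (not b) ⇔ (¬ T b)
T-not⇔¬T true  = mk⇔ (λ ()) (λ ¬t → ¬t tt)
T-not⇔¬T false = mk⇔ (λ _ ()) (λ _ → tt)

T-or-T-not : ∀ b → T b ⊎ T (not b)
T-or-T-not true  = inj₁ tt
T-or-T-not false = inj₂ tt

decide : ExcludedMiddle (lsuc 0ℓ) → (X : Set) → Dec X
decide em X = map′ lower lift (em {Lift (lsuc 0ℓ) X})

wf-minimal : ExcludedMiddle (lsuc 0ℓ) → {A : Set} {_<_ : A → A → Set} →
             WellFounded _<_ → A → Σ[ y ∈ A ] (∀ z → ¬ z < y)
wf-minimal em {A} {_<_} <-wf x = descend x (<-wf x)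
  where
  descend : ∀ x → Acc _<_ x → Σ[ y ∈ A ] (∀ z → ¬ z < y)
  descend x (acc rs) with decide em (Σ[ z ∈ A ] z < x)
  ... | yes (z , z<x) = descend z (rs z<x)
  ... | no ¬z<x       = x , λ z z<x → ¬z<x (z , z<x)

Least : ∀ {n} → (Fin n → Set) → Fin n → Set
Least Q i = Q i × (∀ j → j <ᶠ i → ¬ Q j)

least-exists : ∀ {n} {Q : Fin n → Set} → (∀ i → Dec (Q i)) →
               ∀ i → Q i → Σ (Fin n) (Least Q)
least-exists {suc n} {Q} Q? i q with Q? Fin.zero
... | yes q₀ = Fin.zero , q₀ , λ _ ()
... | no ¬q₀ = later i q
  where
  later : ∀ i → Q i → Σ (Fin (suc n)) (Least Q)
  later Fin.zero    q = ⊥-elim (¬q₀ q)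
  later (Fin.suc i) q with least-exists (Q? ∘ Fin.suc) i q
  ... | k , qk , below = Fin.suc k , qk , earlier
    where
    earlier : ∀ j → j <ᶠ Fin.suc k → ¬ Q j
    earlier Fin.zero    _         = ¬q₀
    earlier (Fin.suc j) (s≤s j<k) = below j j<k

Least-unique : ∀ {n} {Q : Fin n → Set} {i j} → Least Q i → Least Q j → i ≡ j
Least-unique {i = i} {j} (qi , below-i) (qj , below-j) with Finₚ.<-cmp i j
... | tri< i<j _ _ = ⊥-elim (below-j i i<j qi)
... | tri≈ _ i≡j _ = i≡j
... | tri> _ _ j<i = ⊥-elim (below-i j j<i qj)

⊤ᶠ : ∀ {A n} → Formula A n
⊤ᶠ = All (Eq Fin.zero Fin.zero)

⊥ᶠ : ∀ {A n} → Formula A n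
⊥ᶠ = Neg ⊤ᶠ

⊤ᶠ-sat : ∀ {A n} (w : OWord A) (e : Fin n → P w) → Sat w ⊤ᶠ e
⊤ᶠ-sat w e p = refl

onlyIf : ∀ {A} {X : Set} → Dec X → Sentence A → Sentence A
onlyIf (yes _) φ = φ
onlyIf (no _)  φ = ⊥ᶠ

onlyIf-⊨ : ∀ {A} {X : Set} (d : Dec X) (φ : Sentence A) (w : OWord A) →
           (w ⊨ onlyIf d φ) ⇔ (X × (w ⊨ φ))
onlyIf-⊨ (yes x) φ w = mk⇔ (x ,_) proj₂
onlyIf-⊨ (no ¬x) φ w =
  mk⇔ (λ s → ⊥-elim (s (⊤ᶠ-sat {n = 0} w (λ ())))) (λ (x , _) → ⊥-elim (¬x x))

⋁ : ∀ {A n} → (Fin n → Sentence A) → Sentence A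
⋁ {n = zero}  φ = ⊥ᶠ
⋁ {n = suc n} φ = Or (φ Fin.zero) (⋁ (φ ∘ Fin.suc))

⋁-⊨ : ∀ {A n} (φ : Fin n → Sentence A) (w : OWord A) →
      (w ⊨ ⋁ φ) ⇔ (Σ[ i ∈ Fin n ] (w ⊨ φ i))
⋁-⊨ {n = zero}  φ w = mk⇔ (λ s → ⊥-elim (s (⊤ᶠ-sat {n = 0} w (λ ())))) (λ ())
⋁-⊨ {n = suc n} φ w = mk⇔
  [ (λ s → Fin.zero , s) , (λ s → let (i , t) = to (⋁-⊨ (φ ∘ Fin.suc) w) s in Fin.suc i , t) ]
  (λ { (Fin.zero , s) → inj₁ s ; (Fin.suc i , s) → inj₂ (from (⋁-⊨ (φ ∘ Fin.suc) w) (i , s)) })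

record _↪_onto_ {A : Set} (u w : OWord A) (g : P w → Bool) : Set where
  field
    emb        : P u → P w
    emb-≺      : ∀ a b → _≺_ (dom u) a b ⇔ _≺_ (dom w) (emb a) (emb b)
    emb-inj    : ∀ a b → emb a ≡ emb b → a ≡ b
    emb-letter : ∀ a → letter u a ≡ letter w (emb a)
    emb-in     : ∀ a → T (g (emb a))
    emb-onto   : ∀ p → T (g p) → Σ[ a ∈ P u ] emb a ≡ p

module _ {A : Set} (w : OWord A) (g : P w → Bool) where
  private
    module W = IsStrictTotalOrder (isSTO (dom w))

    Selected : Set
    Selected = Σ (P w) (T ∘ g)

    Selected-≡ : {a b : Selected} → proj₁ a ≡ proj₁ b → a ≡ b
    Selected-≡ {p , s} {.p , t} refl = cong (p ,_) (T-irrelevant s t)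

    _≺ˢ_ : Selected → Selected → Set
    a ≺ˢ b = _≺_ (dom w) (proj₁ a) (proj₁ b)

    ≺ˢ-isStrictTotalOrder : IsStrictTotalOrder _≡_ _≺ˢ_
    ≺ˢ-isStrictTotalOrder = record
      { isStrictPartialOrder = record
        { isEquivalence = isEquivalence
        ; irrefl        = W.irrefl ∘ cong proj₁
        ; trans         = W.trans
        ; <-resp-≈      = (λ {a} b≡c → subst (a ≺ˢ_) b≡c) , (λ {a} b≡c → subst (_≺ˢ a) b≡c) }
      ; compare = λ a b → lift-tri (W.compare (proj₁ a) (proj₁ b)) }
      where
      lift-tri : ∀ {a b} → Tri (a ≺ˢ b) (proj₁ a ≡ proj₁ b) (b ≺ˢ a) → Tri (a ≺ˢ b) (a ≡ b) (b ≺ˢ a)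
      lift-tri (tri< lt ne gt) = tri< lt (ne ∘ cong proj₁) gt
      lift-tri (tri≈ lt eq gt) = tri≈ lt (Selected-≡ eq) gt
      lift-tri (tri> lt ne gt) = tri> lt (ne ∘ cong proj₁) gt

  restrict : OWord A
  restrict = mkWord selectedOrdinal (letter w ∘ proj₁)
    where
    selectedOrdinal : CountableOrdinal
    selectedOrdinal = record
      { Pos = Selected ; _≺_ = _≺ˢ_ ; isSTO = ≺ˢ-isStrictTotalOrder
      ; wf = On.wellFounded proj₁ (wf (dom w))
      ; enc = enc (dom w) ∘ proj₁ ; enc-inj = Selected-≡ ∘ enc-inj (dom w) }

  restrict-↪ : restrict ↪ w onto g
  restrict-↪ = record
    { emb = proj₁ ; emb-≺ = λ _ _ → mk⇔ id id ; emb-inj = λ _ _ → Selected-≡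
    ; emb-letter = λ _ → refl ; emb-in = proj₂ ; emb-onto = λ p t → (p , t) , refl }

-- A guard is a formula in one variable and k parameters, taking the
-- positions of its variable and parameters as arguments, so that it can
-- be instantiated under binders without a substitution operation.
Guard : Set → ℕ → Set
Guard A k = ∀ {m} → Fin m → (Fin k → Fin m) → Formula A m

record Defines {A : Set} {k : ℕ} (w : OWord A) (G : Guard A k)
               (g : P w → Bool) (xs : Fin k → P w) : Set where
  constructor defines
  field
    guard-sat : ∀ {m} (env : Fin m → P w) y (ps : Fin k → Fin m) →
                (∀ j → env (ps j) ≡ xs j) → Sat w (G y ps) env ⇔ T (g (env y))

relativise : ∀ {A k n} → Guard A k → Formula A n → Formula A (n + k)
relativise {k = k} G (Lt i j)  = Lt (i ↑ˡ k) (j ↑ˡ k)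
relativise {k = k} G (Eq i j)  = Eq (i ↑ˡ k) (j ↑ˡ k)
relativise {k = k} G (Let a i) = Let a (i ↑ˡ k)
relativise G (Neg φ)   = Neg (relativise G φ)
relativise G (And φ ψ) = And (relativise G φ) (relativise G ψ)
relativise G (Or φ ψ)  = Or (relativise G φ) (relativise G ψ)
relativise {n = n} G (Ex φ)  = Ex (And (G Fin.zero (suc n ↑ʳ_)) (relativise G φ))
relativise {n = n} G (All φ) = All (Or (Neg (G Fin.zero (suc n ↑ʳ_))) (relativise G φ))

module Relativisation {A : Set} {k : ℕ} {G : Guard A k} {u w : OWord A} {g : P w → Bool}
                      (E : u ↪ w onto g) {xs : Fin k → P w} (G-defines : Defines w G g xs) where
  open _↪_onto_ E

  extend-agrees : ∀ {n} {e : Fin n → P u} {e' : Fin (n + k) → P w} {a p} → emb a ≡ p →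
                  (∀ i → emb (e i) ≡ e' (i ↑ˡ k)) →
                  ∀ i → emb (extend a e i) ≡ extend p e' (i ↑ˡ k)
  extend-agrees a↦p agree Fin.zero    = a↦p
  extend-agrees a↦p agree (Fin.suc i) = agree i

  bound-variable-guard : ∀ {n} (e' : Fin (n + k) → P w) → (∀ j → e' (n ↑ʳ j) ≡ xs j) →
                         ∀ p → Sat w (G Fin.zero (suc n ↑ʳ_)) (extend p e') ⇔ T (g p)
  bound-variable-guard e' params p = Defines.guard-sat G-defines (extend p e') Fin.zero _ params

  relativise-sat : ∀ {n} (φ : Formula A n) (e : Fin n → P u) (e' : Fin (n + k) → P w) →
                   (∀ i → emb (e i) ≡ e' (i ↑ˡ k)) → (∀ j → e' (n ↑ʳ j) ≡ xs j) →
                   Sat u φ e ⇔ Sat w (relativise G φ) e'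
  relativise-sat (Lt i j) e e' agree _ = mk⇔
    (λ s → subst₂ (_≺_ (dom w)) (agree i) (agree j) (to (emb-≺ _ _) s))
    (λ s → from (emb-≺ _ _) (subst₂ (_≺_ (dom w)) (sym (agree i)) (sym (agree j)) s))
  relativise-sat (Eq i j) e e' agree _ = mk⇔
    (λ s → trans (sym (agree i)) (trans (cong emb s) (agree j)))
    (λ s → emb-inj _ _ (trans (agree i) (trans s (sym (agree j)))))
  relativise-sat (Let a i) e e' agree _ = mk⇔
    (λ s → trans (cong (letter w) (sym (agree i))) (trans (sym (emb-letter _)) s))
    (λ s → trans (emb-letter _) (trans (cong (letter w) (agree i)) s))
  relativise-sat (Neg φ) e e' agree params =
    let r = relativise-sat φ e e' agree params in mk⇔ (λ s t → s (from r t)) (λ s t → s (to r t))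
  relativise-sat (And φ ψ) e e' agree params =
    let r = relativise-sat φ e e' agree params ; r' = relativise-sat ψ e e' agree params
    in mk⇔ (λ (s , t) → to r s , to r' t) (λ (s , t) → from r s , from r' t)
  relativise-sat (Or φ ψ) e e' agree params =
    let r = relativise-sat φ e e' agree params ; r' = relativise-sat ψ e e' agree params
    in mk⇔ [ inj₁ ∘ to r , inj₂ ∘ to r' ] [ inj₁ ∘ from r , inj₂ ∘ from r' ]
  relativise-sat {n} (Ex φ) e e' agree params = mk⇔
    (λ (a , s) → emb a , from (guard (emb a)) (emb-in a) , to (body refl) s)
    (λ (p , gp , s) → let (a , a↦p) = emb-onto p (to (guard p) gp) in a , from (body a↦p) s)
    where
    guard : ∀ p → Sat w (G Fin.zero (suc n ↑ʳ_)) (extend p e') ⇔ T (g p)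
    guard = bound-variable-guard e' params
    body : ∀ {a p} → emb a ≡ p → Sat u φ (extend a e) ⇔ Sat w (relativise G φ) (extend p e')
    body a↦p = relativise-sat φ _ _ (extend-agrees a↦p agree) params
  relativise-sat {n} (All φ) e e' agree params = mk⇔
    (λ s p → [ (λ gp → let (a , a↦p) = emb-onto p gp in inj₂ (to (body a↦p) (s a)))
             , (λ ¬gp → inj₁ (to (T-not⇔¬T (g p)) ¬gp ∘ to (guard p))) ] (T-or-T-not (g p)))
    (λ s a → [ (λ ¬G → ⊥-elim (¬G (from (guard (emb a)) (emb-in a))))
             , from (body refl) ] (s (emb a)))
    where
    guard : ∀ p → Sat w (G Fin.zero (suc n ↑ʳ_)) (extend p e') ⇔ T (g p)
    guard = bound-variable-guard e' params
    body : ∀ {a p} → emb a ≡ p → Sat u φ (extend a e) ⇔ Sat w (relativise G φ) (extend p e')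
    body a↦p = relativise-sat φ _ _ (extend-agrees a↦p agree) params

  relativise-⊨ : (φ : Sentence A) → (u ⊨ φ) ⇔ Sat w (relativise G φ) xs
  relativise-⊨ φ = relativise-sat φ (λ ()) xs (λ ()) (λ _ → refl)

complement : ∀ {A k} → Guard A k → Guard A k
complement G y ps = Neg (G y ps)

complement-defines : ∀ {A k} {w : OWord A} {G : Guard A k} {g xs} →
                     Defines w G g xs → Defines w (complement G) (not ∘ g) xs
complement-defines {g = g} G-defines = defines λ env y ps params →
  let r = Defines.guard-sat G-defines env y ps params ; r' = T-not⇔¬T (g (env y))
  in mk⇔ (λ ¬G → from r' (¬G ∘ from r)) (λ t → to r' t ∘ to r)

before : ∀ {A} → Guard A 1
before y ps = Lt y (ps Fin.zero)

everywhere : ∀ {A} → Guard A 0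
everywhere _ _ = ⊤ᶠ

≺-dec : ∀ {A} (w : OWord A) (p q : P w) → Dec (_≺_ (dom w) p q)
≺-dec w = IsStrictTotalOrder._<?_ (isSTO (dom w))

before-defines : ∀ {A} {w : OWord A} (xs : Fin 1 → P w) →
                 Defines w before (λ p → isYes (≺-dec w p (xs Fin.zero))) xs
before-defines {w = w} xs = defines λ env y ps params → mk⇔
  (λ lt → fromWitness (subst (_≺_ (dom w) (env y)) (params Fin.zero) lt))
  (λ t → subst (_≺_ (dom w) (env y)) (sym (params Fin.zero)) (toWitness t))

everywhere-defines : ∀ {A} {w : OWord A} → Defines w everywhere (λ _ → true) (λ ())
everywhere-defines {w = w} = defines λ env y ps _ → mk⇔ _ (λ _ → ⊤ᶠ-sat w env)

DownClosed : ∀ {A} (w : OWord A) → (P w → Bool) → Set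
DownClosed w g = ∀ p q → _≺_ (dom w) q p → T (g p) → T (g q)

module _ {A : Set} (w : OWord A) (g : P w → Bool) (down : DownClosed w g) where
  private
    module W = IsStrictTotalOrder (isSTO (dom w))
    u = restrict w g
    v = restrict w (not ∘ g)

    contra : ∀ {p} {B : Set} → T (g p) → T (not (g p)) → B
    contra {p} t f = ⊥-elim (to (T-not⇔¬T (g p)) f t)

    side : ∀ p → T (g p) ⊎ T (not (g p)) → P u ⊎ P v
    side p (inj₁ t) = inj₁ (p , t)
    side p (inj₂ f) = inj₂ (p , f)

    split : P w → P u ⊎ P v
    split p = side p (T-or-T-not (g p))

    split-from : ∀ s → split ([ proj₁ , proj₁ ] s) ≡ s
    split-from (inj₁ (p , t)) with T-or-T-not (g p)
    ... | inj₁ t' = cong (λ t → inj₁ (p , t)) (T-irrelevant t' t)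
    ... | inj₂ f  = contra t f
    split-from (inj₂ (p , f)) with T-or-T-not (g p)
    ... | inj₁ t  = contra t f
    ... | inj₂ f' = cong (λ f → inj₂ (p , f)) (T-irrelevant f' f)

    from-split : ∀ p → [ proj₁ , proj₁ ] (split p) ≡ p
    from-split p with T-or-T-not (g p)
    ... | inj₁ _ = refl
    ... | inj₂ _ = refl

    selected-before-rest : ∀ p q → T (g p) → T (not (g q)) → _≺_ (dom w) p q
    selected-before-rest p q t f with W.compare p q
    ... | tri< p<q _ _ = p<q
    ... | tri≈ _ refl _ = contra t f
    ... | tri> _ _ q<p = contra (down p q q<p t) f

    split-≺ : ∀ p q → _≺_ (dom w) p q ⇔ Lex⊎ (_≺_ (dom u)) (_≺_ (dom v)) (split p) (split q)
    split-≺ p q with T-or-T-not (g p) | T-or-T-not (g q)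
    ... | inj₁ _ | inj₁ _ = mk⇔ id id
    ... | inj₁ t | inj₂ f = mk⇔ _ (λ _ → selected-before-rest p q t f)
    ... | inj₂ f | inj₁ t = mk⇔ (λ p<q → contra (down q p p<q t) f) (λ ())
    ... | inj₂ _ | inj₂ _ = mk⇔ id id

    split-letter : ∀ p → letter w p ≡ [ letter u , letter v ] (split p)
    split-letter p with T-or-T-not (g p)
    ... | inj₁ _ = refl
    ... | inj₂ _ = refl

  restrict-split : IsConcat₂ w (restrict w g) (restrict w (not ∘ g))
  restrict-split = record
    { iso = mk↔ₛ′ split [ proj₁ , proj₁ ] split-from from-split
    ; iso-ord = split-≺ ; iso-letter = split-letter }

pair : ∀ {A} → OWord A → OWord A → Fin 2 → OWord A
pair u v Fin.zero    = u
pair u v (Fin.suc _) = v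

module _ {A : Set} {u v : OWord A} where
  private
    ⊎→Σ : P u ⊎ P v → Σ (Fin 2) (P ∘ pair u v)
    ⊎→Σ (inj₁ a) = Fin.zero , a
    ⊎→Σ (inj₂ b) = Fin.suc Fin.zero , b

    Σ→⊎ : Σ (Fin 2) (P ∘ pair u v) → P u ⊎ P v
    Σ→⊎ (Fin.zero , a)          = inj₁ a
    Σ→⊎ (Fin.suc Fin.zero , b) = inj₂ b

    ⊎↔Σ : (P u ⊎ P v) ↔ Σ (Fin 2) (P ∘ pair u v)
    ⊎↔Σ = mk↔ₛ′ ⊎→Σ Σ→⊎
      (λ { (Fin.zero , _) → refl ; (Fin.suc Fin.zero , _) → refl })
      [ (λ _ → refl) , (λ _ → refl) ]

    Lex⊎⇔LexΣ : ∀ s t → Lex⊎ (_≺_ (dom u)) (_≺_ (dom v)) s t ⇔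
                        LexΣ (finOrd 2) (pair u v) (⊎→Σ s) (⊎→Σ t)
    Lex⊎⇔LexΣ (inj₁ a) (inj₁ b) =
      mk⇔ (λ a<b → inj₂ (refl , a<b)) (λ { (inj₁ ()) ; (inj₂ (refl , a<b)) → a<b })
    Lex⊎⇔LexΣ (inj₁ a) (inj₂ b) = mk⇔ (λ _ → inj₁ (s≤s z≤n)) _
    Lex⊎⇔LexΣ (inj₂ a) (inj₁ b) = mk⇔ (λ ()) (λ { (inj₁ ()) ; (inj₂ (() , _)) })
    Lex⊎⇔LexΣ (inj₂ a) (inj₂ b) =
      mk⇔ (λ a<b → inj₂ (refl , a<b)) (λ { (inj₁ (s≤s ())) ; (inj₂ (refl , a<b)) → a<b })

    letter-⊎→Σ : ∀ s → [ letter u , letter v ] s ≡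
                       letter (pair u v (proj₁ (⊎→Σ s))) (proj₂ (⊎→Σ s))
    letter-⊎→Σ (inj₁ _) = refl
    letter-⊎→Σ (inj₂ _) = refl

  IsConcat₂⇒IsConcat : ∀ {w} → IsConcat₂ w u v → IsConcat w (finOrd 2) (pair u v)
  IsConcat₂⇒IsConcat c = record
    { iso = ⊎↔Σ ↔-∘ iso
    ; iso-ord = λ p q → let r = iso-ord p q ; r' = Lex⊎⇔LexΣ (I.to p) (I.to q)
                        in mk⇔ (to r' ∘ to r) (from r ∘ from r')
    ; iso-letter = λ p → trans (iso-letter p) (letter-⊎→Σ (I.to p)) }
    where
    open IsConcat₂ c
    module I = Inverse iso

module Concat₂ {A : Set} {w u v : OWord A} (c : IsConcat₂ w u v) where
  open IsConcat₂ c
  private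
    module I = Inverse iso

    from-≺ : ∀ s t → _≺_ (dom w) (I.from s) (I.from t) ⇔ Lex⊎ (_≺_ (dom u)) (_≺_ (dom v)) s t
    from-≺ s t = mk⇔
      (subst₂ Lex (I.strictlyInverseˡ s) (I.strictlyInverseˡ t) ∘ to r)
      (from r ∘ subst₂ Lex (sym (I.strictlyInverseˡ s)) (sym (I.strictlyInverseˡ t)))
      where
      r = iso-ord (I.from s) (I.from t)
      Lex = Lex⊎ (_≺_ (dom u)) (_≺_ (dom v))

    from-letter : ∀ s → letter w (I.from s) ≡ [ letter u , letter v ] s
    from-letter s = trans (iso-letter _) (cong [ letter u , letter v ] (I.strictlyInverseˡ s))

    from-injective : ∀ {s t} → I.from s ≡ I.from t → s ≡ t
    from-injective {s} {t} e =
      trans (sym (I.strictlyInverseˡ s)) (trans (cong I.to e) (I.strictlyInverseˡ t))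

  inl : P u → P w
  inl = I.from ∘ inj₁

  inr : P v → P w
  inr = I.from ∘ inj₂

  inl-≺-inr : ∀ a b → _≺_ (dom w) (inl a) (inr b)
  inl-≺-inr a b = from (from-≺ (inj₁ a) (inj₂ b)) tt

  inr-reflects-≺ : ∀ {a b} → _≺_ (dom w) (inr a) (inr b) → _≺_ (dom v) a b
  inr-reflects-≺ = to (from-≺ (inj₂ _) (inj₂ _))

  record Separates (g : P w → Bool) : Set where
    field
      left-in   : ∀ a → T (g (inl a))
      right-out : ∀ b → T (not (g (inr b)))

  module _ {g : P w → Bool} (sep : Separates g) where
    open Separates sep

    inl-↪ : u ↪ w onto g
    inl-↪ = record
      { emb = inl ; emb-≺ = λ a b → mk⇔ (from (from-≺ _ _)) (to (from-≺ _ _))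
      ; emb-inj = λ _ _ → inj₁-injective ∘ from-injective
      ; emb-letter = λ a → sym (from-letter (inj₁ a)) ; emb-in = left-in ; emb-onto = onto }
      where
      onto : ∀ p → T (g p) → Σ[ a ∈ P u ] inl a ≡ p
      onto p t with I.to p | I.strictlyInverseʳ p
      ... | inj₁ a | a↦p = a , a↦p
      ... | inj₂ b | b↦p = ⊥-elim (to (T-not⇔¬T _) (right-out b) (subst (T ∘ g) (sym b↦p) t))

    inr-↪ : v ↪ w onto (not ∘ g)
    inr-↪ = record
      { emb = inr ; emb-≺ = λ a b → mk⇔ (from (from-≺ _ _)) (to (from-≺ _ _))
      ; emb-inj = λ _ _ → inj₂-injective ∘ from-injective
      ; emb-letter = λ b → sym (from-letter (inj₂ b)) ; emb-in = right-out ; emb-onto = onto }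
      where
      onto : ∀ p → T (not (g p)) → Σ[ b ∈ P v ] inr b ≡ p
      onto p f with I.to p | I.strictlyInverseʳ p
      ... | inj₂ b | b↦p = b , b↦p
      ... | inj₁ a | a↦p = ⊥-elim (to (T-not⇔¬T _) (subst (T ∘ not ∘ g) (sym a↦p) f) (left-in a))

splitBy : ∀ {A k} → Guard A k → Sentence A → Sentence A → Formula A k
splitBy G φ ψ = And (relativise G φ) (relativise (complement G) ψ)

module _ {A : Set} {k : ℕ} {G : Guard A k} {w : OWord A} {g : P w → Bool} {xs : Fin k → P w}
         (G-defines : Defines w G g xs) (φ ψ : Sentence A) where

  splitBy-sound : DownClosed w g → Sat w (splitBy G φ ψ) xs →
                  IsConcat₂ w (restrict w g) (restrict w (not ∘ g)) ×
                  (restrict w g ⊨ φ) × (restrict w (not ∘ g) ⊨ ψ)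
  splitBy-sound down (sφ , sψ) =
    restrict-split w g down ,
    from (Relativisation.relativise-⊨ (restrict-↪ w g) G-defines φ) sφ ,
    from (Relativisation.relativise-⊨ (restrict-↪ w (not ∘ g)) (complement-defines G-defines) ψ) sψ

  splitBy-complete : ∀ {u v} (c : IsConcat₂ w u v) → Concat₂.Separates c g →
                     u ⊨ φ → v ⊨ ψ → Sat w (splitBy G φ ψ) xs
  splitBy-complete c sep uφ vψ =
    to (Relativisation.relativise-⊨ (Concat₂.inl-↪ c sep) G-defines φ) uφ ,
    to (Relativisation.relativise-⊨ (Concat₂.inr-↪ c sep) (complement-defines G-defines) ψ) vψ

cut : ∀ {A} → Sentence A → Sentence A → Sentence A
cut φ ψ = Or (Ex (splitBy before φ ψ)) (splitBy everywhere φ ψ)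

cut-sound : ∀ {A} (φ ψ : Sentence A) {w : OWord A} → w ⊨ cut φ ψ →
            Σ[ u ∈ OWord A ] Σ[ v ∈ OWord A ] (IsConcat₂ w u v × (u ⊨ φ) × (v ⊨ ψ))
cut-sound φ ψ {w} (inj₁ (x , s)) =
  _ , _ , splitBy-sound (before-defines (extend x (λ ()))) φ ψ before-x-downClosed s
  where
  before-x-downClosed : DownClosed w (λ p → isYes (≺-dec w p x))
  before-x-downClosed p q q<p p<x =
    fromWitness (IsStrictTotalOrder.trans (isSTO (dom w)) q<p (toWitness p<x))
cut-sound φ ψ (inj₂ s) = _ , _ , splitBy-sound everywhere-defines φ ψ (λ _ _ _ _ → tt) s

cut-complete : ExcludedMiddle (lsuc 0ℓ) → ∀ {A} (φ ψ : Sentence A) {w u v : OWord A} →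
               IsConcat₂ w u v → u ⊨ φ → v ⊨ ψ → w ⊨ cut φ ψ
cut-complete em φ ψ {w} {v = v} c uφ vψ with decide em (P v)
... | no ¬v  = inj₂ (splitBy-complete everywhere-defines φ ψ c separates uφ vψ)
  where
  separates : Concat₂.Separates c (λ _ → true)
  separates = record { left-in = λ _ → tt ; right-out = ⊥-elim ∘ ¬v }
... | yes b₀ = inj₁ (x , splitBy-complete (before-defines (extend x (λ ()))) φ ψ c separates uφ vψ)
  where
  open Concat₂ c
  first-of-v : Σ[ b ∈ P v ] (∀ b' → ¬ _≺_ (dom v) b' b)
  first-of-v = wf-minimal em (wf (dom v)) b₀
  x : P w
  x = inr (proj₁ first-of-v)
  separates : Separates (λ p → isYes (≺-dec w p x))
  separates = record
    { left-in   = λ a → fromWitness (inl-≺-inr a (proj₁ first-of-v))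
    ; right-out = λ b → from (T-not⇔¬T _) (proj₂ first-of-v b ∘ inr-reflects-≺ ∘ toWitness) }

module _ (M : OrdinalMonoidWithMerge) where
  open OrdinalMonoidWithMerge M
  open OrdinalMonoid om using (Carrier; size; enum; π; π-assoc)
  private
    module E = Inverse enum
    infixl 30 _·_
    _·_ : Carrier → Carrier → Carrier
    _·_ = mul om

  _≟_ : DecidableEquality Carrier
  _≟_ = via-injection (↔⇒↣ (↔-sym enum)) Finₚ._≟_

  π-concat₂-≤ : ∀ {w u v} → IsConcat₂ w u v → ∀ {a b} → π u ≤ a → π v ≤ b → π w ≤ a · b
  π-concat₂-≤ {w} {u} {v} c {a} {b} πu≤a πv≤b =
    subst (_≤ a · b) (sym (π-assoc w (finOrd 2) (pair u v) (IsConcat₂⇒IsConcat c)))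
          (π-mono (finOrd 2) (π ∘ pair u v) _ factorwise)
    where
    factorwise : ∀ i → π (pair u v i) ≤ _
    factorwise Fin.zero           = πu≤a
    factorwise (Fin.suc Fin.zero) = πv≤b

  Preimages : Set
  Preimages = Carrier → Sentence Carrier

  record ApproximatingRelation (L : Lang Carrier) (Ψ : Preimages) : Set₁ where
    field
      sound    : ∀ w m → w ⊨ Ψ m → L w × π w ≤ m
      complete : ∀ w → L w → Σ[ m ∈ Carrier ] (w ⊨ Ψ m)
  open ApproximatingRelation

  approximant-relation : ∀ {L} (a : FOApproximant M L) →
                         ApproximatingRelation L (FODefinableMap.preimDef (FOApproximant.map a))
  approximant-relation a = record
    { sound    = λ w m s → let (h , fh≡m) = from (preimDef-spec m w) s
                           in h , subst (π w ≤_) fh≡m (approx w h)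
    ; complete = λ w h → fun w h , to (preimDef-spec (fun w h) w) (h , refl) }
    where
    open FOApproximant a
    open FODefinableMap map

  union : Preimages → Preimages → Preimages
  union φ ψ m = Or (φ m) (ψ m)

  ∪-relation : ∀ {K L φ ψ} → ApproximatingRelation K φ → ApproximatingRelation L ψ →
               ApproximatingRelation (K ∪ᴸ L) (union φ ψ)
  ∪-relation RK RL = record
    { sound    = λ w m → [ (λ s → let (h , le) = sound RK w m s in inj₁ h , le)
                         , (λ s → let (h , le) = sound RL w m s in inj₂ h , le) ]
    ; complete = λ w → [ (λ h → let (m , s) = complete RK w h in m , inj₁ s)
                       , (λ h → let (m , s) = complete RL w h in m , inj₂ s) ] }

  product : Preimages → Preimages → Preimages
  product φ ψ m = ⋁ λ i → ⋁ λ j → onlyIf (E.to i · E.to j ≟ m) (cut (φ (E.to i)) (ψ (E.to j)))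

  product-⊨ : ∀ φ ψ w m → (w ⊨ product φ ψ m) ⇔
              (Σ[ a ∈ Carrier ] Σ[ b ∈ Carrier ] (a · b ≡ m × (w ⊨ cut (φ a) (ψ b))))
  product-⊨ φ ψ w m = mk⇔
    (λ s → let (i , s) = to (⋁-⊨ _ w) s ; (j , s) = to (⋁-⊨ _ w) s
           in E.to i , E.to j , to (onlyIf-⊨ (E.to i · E.to j ≟ m) _ w) s)
    (λ (a , b , ab≡m , s) → subst₂ Witnessed (E.strictlyInverseˡ a) (E.strictlyInverseˡ b)
                              (enumerated (E.from a) (E.from b)) ab≡m s)
    where
    Witnessed : Carrier → Carrier → Set
    Witnessed a b = a · b ≡ m → w ⊨ cut (φ a) (ψ b) → w ⊨ product φ ψ m
    enumerated : ∀ i j → Witnessed (E.to i) (E.to j)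
    enumerated i j ab≡m s = from (⋁-⊨ _ w)
      (i , from (⋁-⊨ _ w) (j , from (onlyIf-⊨ (E.to i · E.to j ≟ m) _ w) (ab≡m , s)))

  ·-relation : ExcludedMiddle (lsuc 0ℓ) → ∀ {K L φ ψ} →
               ApproximatingRelation K φ → ApproximatingRelation L ψ →
               ApproximatingRelation (K ·ᴸ L) (product φ ψ)
  ·-relation em {φ = φ} {ψ} RK RL = record
    { sound = λ w m s →
        let (a , b , ab≡m , s) = to (product-⊨ φ ψ w m) s
            (u , v , c , uφ , vψ) = cut-sound (φ a) (ψ b) s
            (hu , πu≤a) = sound RK u a uφ ; (hv , πv≤b) = sound RL v b vψ
        in (u , v , hu , hv , c) , subst (π w ≤_) ab≡m (π-concat₂-≤ c πu≤a πv≤b)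
    ; complete = λ { w (u , v , hu , hv , c) →
        let (a , uφ) = complete RK u hu ; (b , vψ) = complete RL v hv
        in a · b , from (product-⊨ φ ψ w (a · b))
                        (a , b , refl , cut-complete em (φ a) (ψ b) c uφ vψ) } }

  firstSatisfying : Preimages → Preimages
  firstSatisfying Ψ m = And (Ψ m) (Neg (⋁ λ j → onlyIf (j Finₚ.<? E.from m) (Ψ (E.to j))))

  firstSatisfying-⊨ : ∀ Ψ w m →
                      (w ⊨ firstSatisfying Ψ m) ⇔ Least (λ i → w ⊨ Ψ (E.to i)) (E.from m)
  firstSatisfying-⊨ Ψ w m = mk⇔
    (λ (s , none) → subst (w ⊨_ ∘ Ψ) (sym (E.strictlyInverseˡ m)) s
                  , λ j j<m s' → none (from (⋁-⊨ _ w) (j , from (earlier j) (j<m , s'))))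
    (λ (s , below) → subst (w ⊨_ ∘ Ψ) (E.strictlyInverseˡ m) s
                   , λ some → let (j , s') = to (⋁-⊨ _ w) some ; (j<m , s'') = to (earlier j) s'
                              in below j j<m s'')
    where
    earlier : ∀ j → (w ⊨ onlyIf (j Finₚ.<? E.from m) (Ψ (E.to j))) ⇔
                    (j <ᶠ E.from m × (w ⊨ Ψ (E.to j)))
    earlier j = onlyIf-⊨ (j Finₚ.<? E.from m) _ w

  firstSatisfying-approximant :
    ExcludedMiddle (lsuc 0ℓ) → ∀ {L Ψ} → ApproximatingRelation L Ψ →
    Σ[ a ∈ FOApproximant M L ]
      (∀ m → FODefinableMap.preimDef (FOApproximant.map a) m ≡ firstSatisfying Ψ m)
  firstSatisfying-approximant em {L} {Ψ} R =
    record { map = value-map ; approx = value-approx } , λ _ → refl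
    where
    Holds : OWord Carrier → Fin size → Set
    Holds w i = w ⊨ Ψ (E.to i)

    choice : ∀ w → L w → Σ (Fin size) (Least (Holds w))
    choice w h = let (m , s) = complete R w h in
      least-exists (decide em ∘ Holds w) (E.from m) (subst (w ⊨_ ∘ Ψ) (sym (E.strictlyInverseˡ m)) s)

    value : ∀ w → L w → Carrier
    value w h = E.to (proj₁ (choice w h))

    value-spec : ∀ m w → (Σ[ h ∈ L w ] value w h ≡ m) ⇔ (w ⊨ firstSatisfying Ψ m)
    value-spec m w = mk⇔
      (λ { (h , refl) → let (i , least) = choice w h in
             from (firstSatisfying-⊨ Ψ w _)
                  (subst (Least (Holds w)) (sym (E.strictlyInverseʳ i)) least) })
      (λ s → let h = proj₁ (sound R w m (proj₁ s))
                 i≡m = Least-unique (proj₂ (choice w h)) (to (firstSatisfying-⊨ Ψ w m) s)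
             in h , trans (cong E.to i≡m) (E.strictlyInverseˡ m))

    value-map : FODefinableMap L Carrier
    value-map = record
      { fun = value
      ; fun-irr = λ w h h' → cong E.to (Least-unique (proj₂ (choice w h)) (proj₂ (choice w h')))
      ; preimDef = firstSatisfying Ψ ; preimDef-spec = value-spec }

    value-approx : ∀ w h → π w ≤ value w h
    value-approx w h = proj₂ (sound R w _ (proj₁ (proj₂ (choice w h))))

  ∪-construction : Construction M
  ∪-construction _ _ φ ψ = firstSatisfying (union φ ψ)

  ·-construction : Construction M
  ·-construction _ _ φ ψ = firstSatisfying (product φ ψ)

mainTheorem11 : (M : OrdinalMonoidWithMerge) →
    Σ[ F∪ ∈ Construction M ] Σ[ F· ∈ Construction M ]
      (ExcludedMiddle (lsuc 0ℓ) →
       (K L : Lang (CarrierM M)) (dK : FODefinable K) (dL : FODefinable L)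
       (aK : FOApproximant M K) (aL : FOApproximant M L) →
       (Σ[ a ∈ FOApproximant M (K ∪ᴸ L) ]
          (∀ m → FODefinableMap.preimDef (FOApproximant.map a) m
                 ≡ F∪ (proj₁ dK) (proj₁ dL)
                      (FODefinableMap.preimDef (FOApproximant.map aK))
                      (FODefinableMap.preimDef (FOApproximant.map aL)) m))
       ×
       (Σ[ b ∈ FOApproximant M (K ·ᴸ L) ]
          (∀ m → FODefinableMap.preimDef (FOApproximant.map b) m
                 ≡ F· (proj₁ dK) (proj₁ dL)
                      (FODefinableMap.preimDef (FOApproximant.map aK))
                      (FODefinableMap.preimDef (FOApproximant.map aL)) m)))
mainTheorem11 M = ∪-construction M , ·-construction M , λ em K L _ _ aK aL →
  let RK = approximant-relation M aK ; RL = approximant-relation M aL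
  in firstSatisfying-approximant M em (∪-relation M RK RL) ,
     firstSatisfying-approximant M em (·-relation M em RK RL)
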